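{- For every $t\geq 2$ and every $n\geq 2$, $\lambda(M^t(K_n))=2^t(n+1)-2$.
   Context: $K_n$ is the complete graph on $n$ vertices. An $L(2,1)$-labeling of $G$ is a map $f:V\to\{0,1,2,\dots\}$ with $|f(x)-f(y)|\ge 2$ if $d_G(x,y)=1$ and $|f(x)-f(y)|\ge1$ if $d_G(x,y)=2$; $\lambda(G)$ is the minimum over such $f$ of the largest label. For $V=\{v_1,\dots,v_n\}$, $M(G)$ has vertex set $V\cup\{v_1',\dots,v_n'\}\cup\{u\}$ and edge set $E\cup\{v_iv_j' : v_iv_j\in E\}\cup\{v_i'u: 1\le i\le n\}$; $M^0(G)=G$ and $M^t(G)=M(M^{t-1}(G))$. -}

module Defs where

open import Data.Nat using (ℕ; zero; suc; _+_; _*_; _^_; _∸_; _≤_; _≥_; ∣_-_∣)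
open import Data.Fin using (Fin; zero; suc; splitAt; _≟_)
open import Data.Bool using (Bool; true; false; not; _∧_)
open import Data.Sum using (_⊎_; inj₁; inj₂)
open import Data.Product using (_×_; ∃; Σ)
open import Relation.Nullary using (¬_)
open import Relation.Nullary.Decidable using (⌊_⌋)
open import Relation.Binary.PropositionalEquality using (_≡_)

record Graph : Set where
  constructor graph
  field
    N   : ℕ
    adj : Fin N → Fin N → Bool
open Graph public

K : ℕ → Graph
K n = graph n (λ i j → not ⌊ i ≟ j ⌋)

-- Vertices of M(G): Fin (suc (N + N)); zero = u, suc i with i < N is v_i,
-- suc i with i ≥ N is the shadow vertex v'_{i-N}.
data MV (N : ℕ) : Set where
  vtx  : Fin N → MV N
  shd  : Fin N → MV N
  root : MV N

decode : {N : ℕ} → Fin (suc (N + N)) → MV N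
decode zero = root
decode {N} (suc i) with splitAt N i
... | inj₁ a = vtx a
... | inj₂ b = shd b

madj : (G : Graph) → MV (N G) → MV (N G) → Bool
madj G (vtx i) (vtx j) = adj G i j
madj G (vtx i) (shd j) = adj G i j
madj G (shd i) (vtx j) = adj G j i
madj G (shd i) (shd j) = false
madj G (shd i) root    = true
madj G root    (shd j) = true
madj G (vtx i) root    = false
madj G root    (vtx j) = false
madj G root    root    = false

M : Graph → Graph
M G = graph (suc (N G + N G)) (λ x y → madj G (decode x) (decode y))

Mpow : ℕ → Graph → Graph
Mpow zero    G = G
Mpow (suc t) G = M (Mpow t G)

Dist1 : (G : Graph) → Fin (N G) → Fin (N G) → Set
Dist1 G x y = adj G x y ≡ true

Dist2 : (G : Graph) → Fin (N G) → Fin (N G) → Set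
Dist2 G x y = ¬ (x ≡ y) × (adj G x y ≡ false) × ∃ λ z → (adj G x z ≡ true) × (adj G z y ≡ true)

IsL21 : (G : Graph) → (Fin (N G) → ℕ) → Set
IsL21 G f = (∀ x y → Dist1 G x y → ∣ f x - f y ∣ ≥ 2)
          × (∀ x y → Dist2 G x y → ∣ f x - f y ∣ ≥ 1)

LambdaIs : Graph → ℕ → Set
LambdaIs G k =
    (Σ (Fin (N G) → ℕ) λ f → IsL21 G f × (∀ x → f x ≤ k))
  × (∀ f → IsL21 G f → ∃ λ x → k ≤ f x)

{-# OPTIONS --safe #-}
-- Any two vertices of M^t(K_n) are at distance at most two (M preserves this), so an
-- L(2,1)-labelling is injective and its largest label is at least |V| − 1. Conversely, labelling
-- the vertices injectively by 0, …, |V| − 1 with adjacent vertices at least 2 apart attains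
-- |V| − 1. Such a labelling f of G yields one of M(G) by v ↦ 2f(v)+1, v′ ↦ 2f(v)+2, u ↦ 0;
-- K_n has none, but M²(K_n) has one that can be written down directly. Finally
-- |V(M^t(K_n))| + 1 = 2^t (n + 1).
module Submission where

open import Defs
open import Data.Nat using (ℕ; _+_; _*_; _^_; _∸_; _≥_)
open import Data.Nat using (zero; suc; _≤_; _<_; z≤n; s≤s; ∣_-_∣; _≤?_)
open import Data.Nat.Properties hiding (_≟_)
open import Data.Nat.DivMod using (_%_; [m+kn]%n≡m%n; m<n⇒m%n≡m)
open import Data.Nat.Tactic.RingSolver using (solve-∀)
open import Data.Fin using (Fin; zero; suc; splitAt; _↑ˡ_; _↑ʳ_; toℕ; fromℕ<; _≟_)
open import Data.Fin.Patterns using (0F; 1F; 2F)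
open import Data.Fin.Properties using (splitAt-↑ˡ; splitAt-↑ʳ; splitAt⁻¹-↑ˡ; splitAt⁻¹-↑ʳ; toℕ-injective; toℕ<n; fromℕ<-injective; any?; pigeonhole)
open import Data.Bool using (true; false)
open import Data.Maybe using (Maybe; just; nothing)
open import Data.Maybe.Properties using (just-injective)
open import Data.Sum using (_⊎_; inj₁; inj₂; [_,_])
open import Data.Product using (∃; _×_; _,_; proj₁; proj₂)
open import Function.Base using (_∘_)
open import Function.Definitions using (Injective)
open import Relation.Nullary using (yes; no; contradiction)
open import Relation.Binary.PropositionalEquality using (_≡_; _≢_; refl; sym; trans; cong; cong₂; subst; module ≡-Reasoning)

≤∣-∣-sym : ∀ {d} a b → d ≤ ∣ a - b ∣ → d ≤ ∣ b - a ∣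
≤∣-∣-sym {d} a b = subst (d ≤_) (∣-∣-comm a b)

m+n≤o⇒m≤∣o-n∣ : ∀ {d a b} → d + a ≤ b → d ≤ ∣ b - a ∣
m+n≤o⇒m≤∣o-n∣ {d} {a} {b} le = ≤-trans (m+n≤o⇒m≤o∸n d le) (m∸n≤∣m-n∣ b a)

∣-∣-offsets : ∀ r s x y → ∣ x - y ∣ ≤ ∣ r + x - s + y ∣ + ∣ r - s ∣
∣-∣-offsets r s x y = begin
  ∣ x - y ∣                                ≡⟨ ∣m+n-m+o∣≡∣n-o∣ r x y ⟨
  ∣ r + x - r + y ∣                        ≤⟨ ∣-∣-triangle (r + x) (s + y) (r + y) ⟩
  ∣ r + x - s + y ∣ + ∣ s + y - r + y ∣    ≡⟨ cong (∣ r + x - s + y ∣ +_) shift ⟩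
  ∣ r + x - s + y ∣ + ∣ r - s ∣            ∎
  where
  open ≤-Reasoning
  shift : ∣ s + y - r + y ∣ ≡ ∣ r - s ∣
  shift = begin-equality
    ∣ s + y - r + y ∣   ≡⟨ cong₂ ∣_-_∣ (+-comm s y) (+-comm r y) ⟩
    ∣ y + s - y + r ∣   ≡⟨ ∣m+n-m+o∣≡∣n-o∣ y s r ⟩
    ∣ s - r ∣           ≡⟨ ∣-∣-comm s r ⟩
    ∣ r - s ∣           ∎

∣-∣-blocks : ∀ c r s a b → ∣ a - b ∣ * c ≤ ∣ r + a * c - s + b * c ∣ + ∣ r - s ∣
∣-∣-blocks c r s a b =
  subst (_≤ ∣ r + a * c - s + b * c ∣ + ∣ r - s ∣) (sym (*-distribʳ-∣-∣ c a b)) (∣-∣-offsets r s (a * c) (b * c))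

blocks-apart : ∀ c r s a b → 3 ≤ ∣ a - b ∣ * c → ∣ r - s ∣ ≤ 1 → 2 ≤ ∣ r + a * c - s + b * c ∣
blocks-apart c r s a b 3≤ ∣r-s∣≤1 =
  +-cancelʳ-≤ 1 2 _ (≤-trans 3≤ (≤-trans (∣-∣-blocks c r s a b) (+-monoʳ-≤ _ ∣r-s∣≤1)))

[r+kn]%n≡r : ∀ {n} (r : Fin (suc n)) k → (toℕ r + k * suc n) % suc n ≡ toℕ r
[r+kn]%n≡r {n} r k = trans ([m+kn]%n≡m%n (toℕ r) k (suc n)) (m<n⇒m%n≡m (toℕ<n r))

+-*-injective : ∀ {c} (r s : Fin c) a b → toℕ r + a * c ≡ toℕ s + b * c → r ≡ s × a ≡ b
+-*-injective {suc c} r s a b e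
  with refl ← toℕ-injective (trans (sym ([r+kn]%n≡r r a)) (trans (cong (_% suc c) e) ([r+kn]%n≡r s b)))
  = refl , *-cancelʳ-≡ a b (suc c) (+-cancelˡ-≡ (toℕ r) _ _ e)

injective⇒large-value : ∀ {K} (f : Fin K → ℕ) → Injective _≡_ _≡_ f → Fin K → ∃ λ x → K ∸ 1 ≤ f x
injective⇒large-value {suc K} f f-inj _ with any? (λ x → K ≤? f x)
... | yes large = large
... | no ¬large with pigeonhole (n<1+n K) (λ x → fromℕ< (≰⇒> (λ K≤fx → ¬large (x , K≤fx))))
...   | i , j , i<j , collide = contradiction (f-inj (fromℕ<-injective _ _ _ _ collide)) (<⇒≢ i<j ∘ cong toℕ)

encode : {N : ℕ} → MV N → Fin (suc (N + N))
encode {N} (vtx a) = suc (a ↑ˡ N)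
encode {N} (shd b) = suc (N ↑ʳ b)
encode root        = zero

decode-encode : {N : ℕ} (p : MV N) → decode (encode p) ≡ p
decode-encode {N} (vtx a) rewrite splitAt-↑ˡ N a N = refl
decode-encode {N} (shd b) rewrite splitAt-↑ʳ N N b = refl
decode-encode root = refl

encode-decode : {N : ℕ} (x : Fin (suc (N + N))) → encode {N} (decode x) ≡ x
encode-decode zero = refl
encode-decode {N} (suc i) with splitAt N i in eq
... | inj₁ a = cong suc (splitAt⁻¹-↑ˡ eq)
... | inj₂ b = cong suc (splitAt⁻¹-↑ʳ eq)

decode-injective : {N : ℕ} → Injective _≡_ _≡_ (decode {N})
decode-injective {N} {x} {y} e = trans (sym (encode-decode x)) (trans (cong encode e) (encode-decode y))

record Diameter≤2 (G : Graph) : Set where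
  field
    adj-sym     : ∀ x y → adj G x y ≡ adj G y x
    neighbour   : ∀ x → ∃ (Dist1 G x)
    close       : ∀ x y → x ≢ y → Dist1 G x y ⊎ Dist2 G x y
    some-vertex : Fin (N G)

module _ {G : Graph} (G-diam : Diameter≤2 G) where
  open Diameter≤2 G-diam

  MClose : MV (N G) → MV (N G) → Set
  MClose p q = madj G p q ≡ true ⊎ (madj G p q ≡ false × ∃ λ r → madj G p r ≡ true × madj G r q ≡ true)

  madj-sym : ∀ p q → madj G p q ≡ madj G q p
  madj-sym (vtx i) (vtx j) = adj-sym i j
  madj-sym (vtx i) (shd j) = refl
  madj-sym (vtx i) root    = refl
  madj-sym (shd i) (vtx j) = refl
  madj-sym (shd i) (shd j) = refl
  madj-sym (shd i) root    = refl
  madj-sym root    (vtx j) = refl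
  madj-sym root    (shd j) = refl
  madj-sym root    root    = refl

  MClose-sym : ∀ p q → MClose q p → MClose p q
  MClose-sym p q (inj₁ e) = inj₁ (trans (madj-sym p q) e)
  MClose-sym p q (inj₂ (f , r , qr , rp)) =
    inj₂ (trans (madj-sym p q) f , r , trans (madj-sym p r) rp , trans (madj-sym r q) qr)

  copy-shadow-close : ∀ i j → MClose (vtx i) (shd j)
  copy-shadow-close i j with adj G i j in eq
  ... | true = inj₁ refl
  ... | false with i ≟ j
  ...   | yes refl = let (z , iz) = neighbour i in inj₂ (refl , vtx z , iz , trans (adj-sym z i) iz)
  ...   | no i≢j with close i j i≢j
  ...     | inj₁ ij = contradiction (trans (sym eq) ij) λ ()
  ...     | inj₂ (_ , _ , z , iz , zj) = inj₂ (refl , vtx z , iz , zj)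

  copy-root-close : ∀ i → MClose (vtx i) root
  copy-root-close i = let (z , iz) = neighbour i in inj₂ (refl , shd z , iz , refl)

  M-close : ∀ p q → p ≢ q → MClose p q
  M-close (vtx i) (vtx j) p≢q with close i j (p≢q ∘ cong vtx)
  ... | inj₁ ij = inj₁ ij
  ... | inj₂ (_ , ij , z , iz , zj) = inj₂ (ij , vtx z , iz , zj)
  M-close (vtx i) (shd j) _   = copy-shadow-close i j
  M-close (shd i) (vtx j) _   = MClose-sym (shd i) (vtx j) (copy-shadow-close j i)
  M-close (vtx i) root    _   = copy-root-close i
  M-close root    (vtx j) _   = MClose-sym root (vtx j) (copy-root-close j)
  M-close (shd i) (shd j) _   = inj₂ (refl , root , refl , refl)
  M-close (shd i) root    _   = inj₁ refl
  M-close root    (shd j) _   = inj₁ refl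
  M-close root    root    p≢q = contradiction refl p≢q

  M-neighbour : ∀ p → ∃ λ r → madj G p r ≡ true
  M-neighbour (vtx i) = let (z , iz) = neighbour i in vtx z , iz
  M-neighbour (shd i) = root , refl
  M-neighbour root    = shd some-vertex , refl

  M-diameter≤2 : Diameter≤2 (M G)
  M-diameter≤2 = record
    { adj-sym     = λ x y → madj-sym (decode x) (decode y)
    ; neighbour   = λ x → let (r , xr) = M-neighbour (decode x) in encode r , into (decode x) r xr
    ; close       = λ x y x≢y →
        Dist-from-MClose x y x≢y (M-close (decode x) (decode y) (x≢y ∘ decode-injective))
    ; some-vertex = zero
    }
    where
    into : ∀ p r → madj G p r ≡ true → madj G p (decode (encode r)) ≡ true
    into p r = subst (λ r′ → madj G p r′ ≡ true) (sym (decode-encode r))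
    out-of : ∀ r q → madj G r q ≡ true → madj G (decode (encode r)) q ≡ true
    out-of r q = subst (λ r′ → madj G r′ q ≡ true) (sym (decode-encode r))
    Dist-from-MClose : ∀ x y → x ≢ y → MClose (decode x) (decode y) → Dist1 (M G) x y ⊎ Dist2 (M G) x y
    Dist-from-MClose x y _ (inj₁ xy) = inj₁ xy
    Dist-from-MClose x y x≢y (inj₂ (xy , r , xr , ry)) =
      inj₂ (x≢y , xy , encode r , into (decode x) r xr , out-of r (decode y) ry)

K-adj-≢ : ∀ {n} {i j : Fin n} → adj (K n) i j ≡ true → i ≢ j
K-adj-≢ {i = i} {j} e with i ≟ j
K-adj-≢ () | yes _
... | no i≢j = i≢j

K-diameter≤2 : ∀ m → Diameter≤2 (K (suc (suc m)))
K-diameter≤2 m = record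
  { adj-sym     = adj-sym
  ; neighbour   = λ { zero → suc zero , refl ; (suc k) → zero , refl }
  ; close       = λ x y x≢y → inj₁ (distinct-adjacent x≢y)
  ; some-vertex = zero
  }
  where
  distinct-adjacent : ∀ {i j : Fin (suc (suc m))} → i ≢ j → adj (K (suc (suc m))) i j ≡ true
  distinct-adjacent {i} {j} i≢j with i ≟ j
  ... | yes i≡j = contradiction i≡j i≢j
  ... | no _    = refl
  adj-sym : ∀ i j → adj (K (suc (suc m))) i j ≡ adj (K (suc (suc m))) j i
  adj-sym i j with i ≟ j | j ≟ i
  ... | yes _   | yes _   = refl
  ... | no _    | no _    = refl
  ... | yes i≡j | no j≢i  = contradiction (sym i≡j) j≢i
  ... | no i≢j  | yes j≡i = contradiction (sym j≡i) i≢j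

Mpow-diameter≤2 : ∀ m t → Diameter≤2 (Mpow t (K (suc (suc m))))
Mpow-diameter≤2 m zero    = K-diameter≤2 m
Mpow-diameter≤2 m (suc t) = M-diameter≤2 (Mpow-diameter≤2 m t)

L21-injective : ∀ {G f} → Diameter≤2 G → IsL21 G f → Injective _≡_ _≡_ f
L21-injective {G} {f} G-diam (apart , distinct) {x} {y} fx≡fy with x ≟ y
... | yes x≡y = x≡y
... | no x≢y  = contradiction (sym (m≡n⇒∣m-n∣≡0 fx≡fy)) (<⇒≢ separated)
  where
  separated : 1 ≤ ∣ f x - f y ∣
  separated = [ ≤-trans (s≤s z≤n) ∘ apart x y , distinct x y ] (Diameter≤2.close G-diam x y x≢y)

record TightLabelling (G : Graph) : Set where
  field
    label     : Fin (N G) → ℕ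
    injective : Injective _≡_ _≡_ label
    apart     : ∀ x y → Dist1 G x y → 2 ≤ ∣ label x - label y ∣
    bounded   : ∀ x → label x < N G

LambdaIs-tight : ∀ {G} → Diameter≤2 G → TightLabelling G → LambdaIs G (N G ∸ 1)
LambdaIs-tight {G} G-diam tight = (label , isL21 , λ x → ∸-monoˡ-≤ 1 (bounded x)) , large-label
  where
  open TightLabelling tight
  isL21 : IsL21 G label
  isL21 = apart , λ x y (x≢y , _) → n≢0⇒n>0 (x≢y ∘ injective ∘ ∣m-n∣≡0⇒m≡n)
  large-label : ∀ f → IsL21 G f → ∃ λ x → N G ∸ 1 ≤ f x
  large-label f f-L21 = injective⇒large-value f (L21-injective G-diam f-L21) (Diameter≤2.some-vertex G-diam)

module Doubling {G : Graph} (tight : TightLabelling G) where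
  open TightLabelling tight renaming (label to g)

  doubled : MV (N G) → ℕ
  doubled (vtx a) = 1 + g a * 2
  doubled (shd b) = 2 + g b * 2
  doubled root    = 0

  doubled-injective : Injective _≡_ _≡_ doubled
  doubled-injective {vtx a} {vtx b} e = cong vtx (injective (proj₂ (+-*-injective 1F 1F (g a) (g b) e)))
  doubled-injective {vtx a} {shd b} e with () ← proj₁ (+-*-injective 1F 0F (g a) (suc (g b)) e)
  doubled-injective {shd a} {vtx b} e with () ← proj₁ (+-*-injective 0F 1F (suc (g a)) (g b) e)
  doubled-injective {shd a} {shd b} e =
    cong shd (injective (suc-injective (proj₂ (+-*-injective 0F 0F (suc (g a)) (suc (g b)) e))))
  doubled-injective {root}  {root}  e = refl

  times-two : ∀ {d} → 2 ≤ d → 3 ≤ d * 2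
  times-two 2≤d = ≤-trans (n≤1+n 3) (*-monoˡ-≤ 2 2≤d)

  doubled-apart : ∀ p q → madj G p q ≡ true → 2 ≤ ∣ doubled p - doubled q ∣
  doubled-apart (vtx a) (vtx b) ab = blocks-apart 2 1 1 (g a) (g b) (times-two (apart a b ab)) z≤n
  doubled-apart (vtx a) (shd b) ab = blocks-apart 2 1 2 (g a) (g b) (times-two (apart a b ab)) ≤-refl
  doubled-apart (shd a) (vtx b) ba =
    blocks-apart 2 2 1 (g a) (g b) (times-two (≤∣-∣-sym (g b) (g a) (apart b a ba))) ≤-refl
  doubled-apart (shd a) root    _  = s≤s (s≤s z≤n)
  doubled-apart root    (shd b) _  = s≤s (s≤s z≤n)

  shadow-bounded : ∀ a → 2 + g a * 2 ≤ N G + N G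
  shadow-bounded a = subst (2 + g a * 2 ≤_) (twice (N G)) (*-monoˡ-≤ 2 (bounded a))
    where
    twice : ∀ k → k * 2 ≡ k + k
    twice = solve-∀

  doubled-bounded : ∀ p → doubled p < suc (N G + N G)
  doubled-bounded (vtx a) = s≤s (≤-trans (n≤1+n _) (shadow-bounded a))
  doubled-bounded (shd b) = s≤s (shadow-bounded b)
  doubled-bounded root    = s≤s z≤n

  M-tight : TightLabelling (M G)
  M-tight = record
    { label     = doubled ∘ decode
    ; injective = decode-injective ∘ doubled-injective
    ; apart     = λ x y → doubled-apart (decode x) (decode y)
    ; bounded   = doubled-bounded ∘ decode
    }

module SecondMycielskian {n : ℕ} (1≤n : 1 ≤ n) where

  -- The root of M²(K_n) gets label 0 and the copies of the shadows v′ᵢ of M(K_n) get 1, …, n.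
  data Position : Set where
    bottom : Position
    low    : Fin n → Position
    high   : Maybe (Fin n) → Fin 3 → Position

  index : Maybe (Fin n) → ℕ
  index (just i) = toℕ i
  index nothing  = n

  ⟦_⟧ : Position → ℕ
  ⟦ bottom ⟧   = 0
  ⟦ low i ⟧    = suc (toℕ i)
  ⟦ high m k ⟧ = suc (n + (toℕ k + index m * 3))

  index-injective : Injective _≡_ _≡_ index
  index-injective {just i}  {just j}  e = cong just (toℕ-injective e)
  index-injective {just i}  {nothing} e = contradiction e (<⇒≢ (toℕ<n i))
  index-injective {nothing} {just j}  e = contradiction (sym e) (<⇒≢ (toℕ<n j))
  index-injective {nothing} {nothing} _ = refl

  low≢high : ∀ i x → toℕ i ≢ n + x
  low≢high i x = <⇒≢ (≤-trans (toℕ<n i) (m≤m+n n x))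

  ⟦⟧-injective : Injective _≡_ _≡_ ⟦_⟧
  ⟦⟧-injective {bottom}   {bottom}     _ = refl
  ⟦⟧-injective {low i}    {low j}      e = cong low (toℕ-injective (suc-injective e))
  ⟦⟧-injective {low i}    {high _ _}   e = contradiction (suc-injective e) (low≢high i _)
  ⟦⟧-injective {high _ _} {low j}      e = contradiction (sym (suc-injective e)) (low≢high j _)
  ⟦⟧-injective {high m k} {high m′ k′} e
    with refl , index-m≡index-m′ ← +-*-injective k k′ (index m) (index m′) (+-cancelˡ-≡ n _ _ (suc-injective e))
    = cong (λ m → high m k) (index-injective index-m≡index-m′)
  ⟦⟧-injective {bottom} {low _}    ()
  ⟦⟧-injective {bottom} {high _ _} ()
  ⟦⟧-injective {low _}    {bottom} ()
  ⟦⟧-injective {high _ _} {bottom} ()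

  copyPosition : MV n → Position
  copyPosition (vtx i) = high (just i) 1F
  copyPosition (shd i) = low i
  copyPosition root    = high nothing 1F

  shadowPosition : MV n → Position
  shadowPosition (vtx i) = high (just i) 2F
  shadowPosition (shd i) = high (just i) 0F
  shadowPosition root    = high nothing 0F

  position : MV (suc (n + n)) → Position
  position (vtx y) = copyPosition (decode y)
  position (shd y) = shadowPosition (decode y)
  position root    = bottom

  vertex : Position → MV (suc (n + n))
  vertex bottom              = root
  vertex (low i)             = vtx (encode (shd i))
  vertex (high (just i) 0F)  = shd (encode (shd i))
  vertex (high (just i) 1F)  = vtx (encode (vtx i))
  vertex (high (just i) 2F)  = shd (encode (vtx i))
  vertex (high nothing 0F)   = shd (encode {n} root)
  vertex (high nothing 1F)   = vtx (encode {n} root)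
  vertex (high nothing 2F)   = root

  vertex-position : ∀ p → vertex (position p) ≡ p
  vertex-position (vtx y) = trans (copy (decode y)) (cong vtx (encode-decode y))
    where
    copy : ∀ x → vertex (copyPosition x) ≡ vtx (encode x)
    copy (vtx i) = refl
    copy (shd i) = refl
    copy root    = refl
  vertex-position (shd y) = trans (shadow (decode y)) (cong shd (encode-decode y))
    where
    shadow : ∀ x → vertex (shadowPosition x) ≡ shd (encode x)
    shadow (vtx i) = refl
    shadow (shd i) = refl
    shadow root    = refl
  vertex-position root = refl

  position-injective : Injective _≡_ _≡_ position
  position-injective {p} {q} e = trans (sym (vertex-position p)) (trans (cong vertex e) (vertex-position q))

  slot-close : ∀ (k : Fin 3) → ∣ 1 - toℕ k ∣ ≤ 1
  slot-close 0F = ≤-refl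
  slot-close 1F = z≤n
  slot-close 2F = ≤-refl

  high-apart : ∀ {m m′} → m ≢ m′ → ∀ k → 2 ≤ ∣ ⟦ high m 1F ⟧ - ⟦ high m′ k ⟧ ∣
  high-apart {m} {m′} m≢m′ k =
    subst (2 ≤_) (sym (∣m+n-m+o∣≡∣n-o∣ n _ _))
      (blocks-apart 3 1 (toℕ k) (index m) (index m′) (*-monoˡ-≤ 3 indices-apart) (slot-close k))
    where
    indices-apart : 1 ≤ ∣ index m - index m′ ∣
    indices-apart = n≢0⇒n>0 (m≢m′ ∘ index-injective ∘ ∣m-n∣≡0⇒m≡n)

  low-apart : ∀ i m k → 1 ≤ toℕ k + index m * 3 → 2 ≤ ∣ ⟦ high m k ⟧ - ⟦ low i ⟧ ∣
  low-apart i m k 1≤slot = m+n≤o⇒m≤∣o-n∣ (subst (2 + toℕ i ≤_) (+-comm _ n) (+-mono-≤ 1≤slot (toℕ<n i)))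

  high-above-bottom : ∀ m k → 2 ≤ ⟦ high m k ⟧
  high-above-bottom m k = s≤s (≤-trans 1≤n (m≤m+n n _))

  apex-slot : 1 ≤ n * 3
  apex-slot = ≤-trans 1≤n (m≤m*n n 3)

  just≢just : ∀ {i j} → madj (K n) (vtx i) (vtx j) ≡ true → just i ≢ just j
  just≢just ij = K-adj-≢ ij ∘ just-injective

  copy-apart : ∀ x y → madj (K n) x y ≡ true → 2 ≤ ∣ ⟦ copyPosition x ⟧ - ⟦ copyPosition y ⟧ ∣
  copy-apart (vtx i) (vtx j) ij = high-apart (just≢just ij) 1F
  copy-apart (vtx i) (shd j) _  = low-apart j (just i) 1F (s≤s z≤n)
  copy-apart (shd i) (vtx j) _  = ≤∣-∣-sym ⟦ high (just j) 1F ⟧ ⟦ low i ⟧ (low-apart i (just j) 1F (s≤s z≤n))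
  copy-apart (shd i) root    _  = ≤∣-∣-sym ⟦ high nothing 1F ⟧ ⟦ low i ⟧ (low-apart i nothing 1F (s≤s z≤n))
  copy-apart root    (shd j) _  = low-apart j nothing 1F (s≤s z≤n)

  copy-shadow-apart : ∀ x y → madj (K n) x y ≡ true → 2 ≤ ∣ ⟦ copyPosition x ⟧ - ⟦ shadowPosition y ⟧ ∣
  copy-shadow-apart (vtx i) (vtx j) ij = high-apart (just≢just ij) 2F
  copy-shadow-apart (vtx i) (shd j) ij = high-apart (just≢just ij) 0F
  copy-shadow-apart (shd i) (vtx j) _  = ≤∣-∣-sym ⟦ high (just j) 2F ⟧ ⟦ low i ⟧ (low-apart i (just j) 2F (s≤s z≤n))
  copy-shadow-apart (shd i) root    _  = ≤∣-∣-sym ⟦ high nothing 0F ⟧ ⟦ low i ⟧ (low-apart i nothing 0F apex-slot)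
  copy-shadow-apart root    (shd j) _  = high-apart {nothing} {just j} (λ ()) 0F

  shadow-above-bottom : ∀ x → 2 ≤ ⟦ shadowPosition x ⟧
  shadow-above-bottom (vtx i) = high-above-bottom (just i) 2F
  shadow-above-bottom (shd i) = high-above-bottom (just i) 0F
  shadow-above-bottom root    = high-above-bottom nothing 0F

  label : MV (suc (n + n)) → ℕ
  label p = ⟦ position p ⟧

  label-apart : ∀ p q → madj (M (K n)) p q ≡ true → 2 ≤ ∣ label p - label q ∣
  label-apart (vtx y) (vtx y′) yy′ = copy-apart (decode y) (decode y′) yy′
  label-apart (vtx y) (shd y′) yy′ = copy-shadow-apart (decode y) (decode y′) yy′
  label-apart (shd y) (vtx y′) y′y =
    ≤∣-∣-sym (label (vtx y′)) (label (shd y)) (copy-shadow-apart (decode y′) (decode y) y′y)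
  label-apart (shd y) root     _   = ≤∣-∣-sym 0 (label (shd y)) (shadow-above-bottom (decode y))
  label-apart root    (shd y′) _   = shadow-above-bottom (decode y′)

  top : ℕ
  top = ⟦ high nothing 1F ⟧

  high-bounded : ∀ i k → ⟦ high (just i) k ⟧ ≤ top
  high-bounded i k = s≤s (+-monoʳ-≤ n (≤-trans (<⇒≤ slot<) (n≤1+n (n * 3))))
    where
    slot< : toℕ k + toℕ i * 3 < n * 3
    slot< = ≤-trans (+-monoˡ-≤ (toℕ i * 3) (toℕ<n k)) (*-monoˡ-≤ 3 (toℕ<n i))

  copy-bounded : ∀ x → ⟦ copyPosition x ⟧ ≤ top
  copy-bounded (vtx i) = high-bounded i 1F
  copy-bounded (shd i) = ≤-trans (toℕ<n i) (≤-trans (m≤m+n n _) (n≤1+n _))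
  copy-bounded root    = ≤-refl

  shadow-bounded : ∀ x → ⟦ shadowPosition x ⟧ ≤ top
  shadow-bounded (vtx i) = high-bounded i 2F
  shadow-bounded (shd i) = high-bounded i 0F
  shadow-bounded root    = s≤s (+-monoʳ-≤ n (n≤1+n _))

  label-bounded : ∀ p → label p < suc (suc (n + n) + suc (n + n))
  label-bounded p = s≤s (subst (label p ≤_) (top≡ n) (position-bounded p))
    where
    position-bounded : ∀ p → label p ≤ top
    position-bounded (vtx y) = copy-bounded (decode y)
    position-bounded (shd y) = shadow-bounded (decode y)
    position-bounded root    = z≤n
    top≡ : ∀ k → suc (k + (1 + k * 3)) ≡ suc (k + k) + suc (k + k)
    top≡ = solve-∀

  tight : TightLabelling (M (M (K n)))
  tight = record
    { label     = label ∘ decode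
    ; injective = decode-injective ∘ position-injective ∘ ⟦⟧-injective
    ; apart     = λ x y → label-apart (decode x) (decode y)
    ; bounded   = label-bounded ∘ decode
    }

Mpow-tight : ∀ {n} → 1 ≤ n → ∀ s → TightLabelling (Mpow (2 + s) (K n))
Mpow-tight 1≤n zero    = SecondMycielskian.tight 1≤n
Mpow-tight 1≤n (suc s) = Doubling.M-tight (Mpow-tight 1≤n s)

Mpow-size : ∀ n t → suc (N (Mpow t (K n))) ≡ 2 ^ t * (n + 1)
Mpow-size n zero    = sym (trans (+-identityʳ (n + 1)) (+-comm n 1))
Mpow-size n (suc t) = begin
  suc (suc (V + V))       ≡⟨ double-suc V ⟩
  2 * suc V               ≡⟨ cong (2 *_) (Mpow-size n t) ⟩
  2 * (2 ^ t * (n + 1))   ≡⟨ *-assoc 2 (2 ^ t) (n + 1) ⟨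
  2 ^ suc t * (n + 1)     ∎
  where
  open ≡-Reasoning
  V : ℕ
  V = N (Mpow t (K n))
  double-suc : ∀ v → suc (suc (v + v)) ≡ 2 * suc v
  double-suc = solve-∀

theorem4p2 : ∀ t n → t ≥ 2 → n ≥ 2 → LambdaIs (Mpow t (K n)) (2 ^ t * (n + 1) ∸ 2)
theorem4p2 t@(suc (suc s)) n@(suc (suc m)) (s≤s (s≤s _)) (s≤s (s≤s _)) =
  subst (LambdaIs (Mpow t (K n))) (cong (_∸ 2) (Mpow-size n t))
    (LambdaIs-tight (Mpow-diameter≤2 m t) (Mpow-tight (s≤s z≤n) s))
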